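{- Let $A$ and $B$ be quantifier-free symbolic heaps of array separation logic, written $$A=\Pi:\mathop{*}_{i=1}^n\mathsf{array}(a_i,b_i)*\mathop{*}_{i=1}^k t_i\mapsto u_i,\qquad B=\Pi':\mathop{*}_{i=1}^m\mathsf{array}(c_i,d_i)*\mathop{*}_{i=1}^{\ell} v_i\mapsto w_i.$$ If $\beta(A,B)$ is satisfiable, then there exists a solution seed for $(A,B)$.
   Context: ASL: terms $t ::= x\mid n\mid t+t\mid n t$ over variables and $n\in\mathbb{N}$; pure formulas are conjunctions of $t=t,t\neq t,t\le t,t<t$; spatial formulas $F::=\mathsf{emp}\mid t\mapsto t\mid\mathsf{array}(t,t)\mid F*F$. Pure formulas are evaluated over $\mathbb{N}$ by stacks $s:\mathsf{Var}\to\mathbb{N}$. For quantifier-free $C$, $\lfloor C\rfloor$ replaces every $c\mapsto d$ by $\mathsf{array}(c,c)$; if $\lfloor C\rfloor=\Pi:\mathop{*}_{i=1}^N\mathsf{array}(\hat a_i,\hat b_i)$ then $\gamma(C)=\Pi\wedge\bigwedge_{i}\hat a_i\le\hat b_i\wedge\bigwedge_{i<j}((\hat b_i<\hat a_j)\vee(\hat b_j<\hat a_i))$. Define $\beta(A,B)=\gamma(A)\wedge\gamma(B)\wedge\bigwedge_{j=1}^{\ell}\bigwedge_{i=1}^{n}(v_j<a_i\vee v_j>b_i)\wedge\bigwedge_{i=1}^{k}\bigwedge_{j=1}^{\ell}(t_i\neq v_j\vee u_i=w_j)$. Let $T(A,B)$ be the set of all terms occurring in $A$ or $B$ together with the terms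 $b_i+1$ ($i\le n$), $d_i+1$ ($i\le m$), $t_i+1$ ($i\le k$), $v_i+1$ ($i\le \ell$). A solution seed for $(A,B)$ is a pure formula $\Delta=\bigwedge_{i\in I}\delta_i$ such that: (1) $\Delta$ is satisfiable and $\Delta\models\beta(A,B)$ (every stack satisfying $\Delta$ satisfies $\beta(A,B)$); (2) each $\delta_i$ is of the form $t<u$ or $t=u$ with $t,u\in T(A,B)$; (3) for all $t,u\in T(A,B)$ some $\delta_i$ is $t<u$, $u<t$ or $t=u$. -}

module Defs where

open import Data.Nat using (ℕ; _+_; _*_; _≤_; _<_; _>_)
open import Data.List using (List; []; _∷_; _++_; map; concatMap)
open import Data.List.Relation.Unary.All using (All)
open import Data.List.Relation.Unary.Any using (Any)
open import Data.List.Relation.Unary.AllPairs using (AllPairs)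
open import Data.List.Membership.Propositional using (_∈_)
open import Data.Product using (_×_; _,_; proj₁; proj₂; ∃)
open import Data.Sum using (_⊎_)
open import Relation.Binary.PropositionalEquality using (_≡_; _≢_)

Var : Set
Var = ℕ

data Term : Set where
  var  : Var → Term
  num  : ℕ → Term
  plus : Term → Term → Term
  mul  : ℕ → Term → Term

Stack : Set
Stack = Var → ℕ

⟦_⟧ : Term → Stack → ℕ
⟦ var x ⟧ s = s x
⟦ num n ⟧ s = n
⟦ plus t u ⟧ s = ⟦ t ⟧ s + ⟦ u ⟧ s
⟦ mul n t ⟧ s = n * ⟦ t ⟧ s

data PureAtom : Set where
  eqA  : Term → Term → PureAtom
  neqA : Term → Term → PureAtom
  leA  : Term → Term → PureAtom
  ltA  : Term → Term → PureAtom

Pure : Set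
Pure = List PureAtom

_⊨ₐ_ : Stack → PureAtom → Set
s ⊨ₐ eqA t u  = ⟦ t ⟧ s ≡ ⟦ u ⟧ s
s ⊨ₐ neqA t u = ⟦ t ⟧ s ≢ ⟦ u ⟧ s
s ⊨ₐ leA t u  = ⟦ t ⟧ s ≤ ⟦ u ⟧ s
s ⊨ₐ ltA t u  = ⟦ t ⟧ s < ⟦ u ⟧ s

_⊨ₚ_ : Stack → Pure → Set
s ⊨ₚ Π = All (s ⊨ₐ_) Π

record SymHeap : Set where
  constructor _∶_⊛_
  field
    pure   : Pure
    arrays : List (Term × Term)
    pts    : List (Term × Term)
open SymHeap public

blocks : SymHeap → List (Term × Term)
blocks C = arrays C ++ map (λ p → (proj₁ p , proj₁ p)) (pts C)

γ : SymHeap → Stack → Set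
γ C s = (s ⊨ₚ pure C)
      × All (λ p → ⟦ proj₁ p ⟧ s ≤ ⟦ proj₂ p ⟧ s) (blocks C)
      × AllPairs (λ p q → (⟦ proj₂ p ⟧ s < ⟦ proj₁ q ⟧ s) ⊎ (⟦ proj₂ q ⟧ s < ⟦ proj₁ p ⟧ s)) (blocks C)

β : SymHeap → SymHeap → Stack → Set
β A B s = γ A s × γ B s
  × All (λ vw → All (λ ab → (⟦ proj₁ vw ⟧ s < ⟦ proj₁ ab ⟧ s) ⊎ (⟦ proj₁ vw ⟧ s > ⟦ proj₂ ab ⟧ s)) (arrays A)) (pts B)
  × All (λ tu → All (λ vw → (⟦ proj₁ tu ⟧ s ≢ ⟦ proj₁ vw ⟧ s) ⊎ (⟦ proj₂ tu ⟧ s ≡ ⟦ proj₂ vw ⟧ s)) (pts B)) (pts A)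

atomTerms : PureAtom → List Term
atomTerms (eqA t u)  = t ∷ u ∷ []
atomTerms (neqA t u) = t ∷ u ∷ []
atomTerms (leA t u)  = t ∷ u ∷ []
atomTerms (ltA t u)  = t ∷ u ∷ []

pairTerms : Term × Term → List Term
pairTerms (t , u) = t ∷ u ∷ []

heapTerms : SymHeap → List Term
heapTerms C = concatMap atomTerms (pure C) ++ concatMap pairTerms (arrays C) ++ concatMap pairTerms (pts C)

succT : Term → Term
succT t = plus t (num 1)

TAB : SymHeap → SymHeap → List Term
TAB A B = heapTerms A ++ heapTerms B
  ++ map (λ p → succT (proj₂ p)) (arrays A)
  ++ map (λ p → succT (proj₂ p)) (arrays B)
  ++ map (λ p → succT (proj₁ p)) (pts A)
  ++ map (λ p → succT (proj₁ p)) (pts B)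

Satisfiable : (Stack → Set) → Set
Satisfiable P = ∃ λ (s : Stack) → P s

_⊧_ : (Stack → Set) → (Stack → Set) → Set
P ⊧ Q = ∀ s → P s → Q s

data SeedAtom : Set where
  ltS : Term → Term → SeedAtom
  eqS : Term → Term → SeedAtom

⟦_⟧ₛ : SeedAtom → Stack → Set
⟦ ltS t u ⟧ₛ s = ⟦ t ⟧ s < ⟦ u ⟧ s
⟦ eqS t u ⟧ₛ s = ⟦ t ⟧ s ≡ ⟦ u ⟧ s

⟦_⟧Δ : List SeedAtom → Stack → Set
⟦ Δ ⟧Δ s = All (λ δ → ⟦ δ ⟧ₛ s) Δ

seedTermsIn : List Term → SeedAtom → Set
seedTermsIn T (ltS t u) = t ∈ T × u ∈ T
seedTermsIn T (eqS t u) = t ∈ T × u ∈ T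

IsSolutionSeed : SymHeap → SymHeap → List SeedAtom → Set
IsSolutionSeed A B Δ =
    (Satisfiable ⟦ Δ ⟧Δ × (⟦ Δ ⟧Δ ⊧ β A B))
  × All (seedTermsIn (TAB A B)) Δ
  × (∀ t u → t ∈ TAB A B → u ∈ TAB A B →
       (ltS t u ∈ Δ) ⊎ (ltS u t ∈ Δ) ⊎ (eqS t u ∈ Δ))

module Submission where

-- Fix a stack s satisfying β(A,B) and let T = T(A,B).  The seed is
-- the "order diagram" of s on T: for every pair (t,u) of terms of T it records
-- whichever of t<u, u<t, t=u holds under s.  By construction s satisfies it,
-- its atoms only mention terms of T, and it decides every pair of T.  The one
-- real point is entailment: any stack s' satisfying the diagram induces the
-- same strict order and the same equalities on T as s (we say s' agrees with s
-- on T), hence also the same ≤ and ≠ relations; and β(A,B) is a boolean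
-- combination of such comparisons between terms of T, so it transfers from s
-- to s'.

open import Defs
open import Data.List using (List; []; _∷_; concatMap; cartesianProductWith)
open import Data.List.Relation.Unary.All as All using (All)
open import Data.List.Relation.Unary.AllPairs using (AllPairs; []; _∷_)
open import Data.List.Relation.Unary.Any using (here; there)
open import Data.List.Membership.Propositional using (_∈_)
open import Data.List.Membership.Propositional.Properties
  using (∈-map⁺; ∈-map⁻; ∈-++⁻; ∈-concat⁺′; ∈-cartesianProductWith⁺; ∈-cartesianProductWith⁻)
open import Data.List.Relation.Binary.Subset.Propositional using (_⊆_)
open import Data.List.Relation.Binary.Subset.Propositional.Properties using (xs⊆xs++ys; xs⊆ys++xs)
open import Data.Nat using (_<_; _≤_)
open import Data.Nat.Properties using (<-cmp; <-irrefl; <⇒≤; ≤-reflexive; m≤n⇒m<n∨m≡n)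
open import Data.Product using (∃; _×_; _,_; proj₁; proj₂)
open import Data.Sum as Sum using (_⊎_; inj₁; inj₂)
open import Data.Empty using (⊥-elim)
open import Function using (_∘_)
open import Relation.Binary.Definitions using (tri<; tri≈; tri>)
open import Relation.Binary.PropositionalEquality using (_≡_; _≢_; refl; sym; subst)

AllPairs-mapWith∈ : ∀ {X : Set} {R R′ : X → X → Set} (xs : List X) →
  (∀ {x y} → x ∈ xs → y ∈ xs → R x y → R′ x y) → AllPairs R xs → AllPairs R′ xs
AllPairs-mapWith∈ []       f []         = []
AllPairs-mapWith∈ (x ∷ xs) f (rs ∷ rss) =
  All.tabulate (λ y∈ → f (here refl) (there y∈) (All.lookup rs y∈))
  ∷ AllPairs-mapWith∈ xs (λ x∈ y∈ → f (there x∈) (there y∈)) rss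

termsOf-⊆ : ∀ {X : Set} (f : X → List Term) {x : X} {xs : List X} →
  x ∈ xs → f x ⊆ concatMap f xs
termsOf-⊆ f x∈xs t∈fx = ∈-concat⁺′ t∈fx (∈-map⁺ f x∈xs)

pureTerms-⊆ : ∀ C → concatMap atomTerms (pure C) ⊆ heapTerms C
pureTerms-⊆ C = xs⊆xs++ys _ _

arrayTerms-⊆ : ∀ C → concatMap pairTerms (arrays C) ⊆ heapTerms C
arrayTerms-⊆ C = xs⊆ys++xs _ (concatMap atomTerms (pure C)) ∘ xs⊆xs++ys _ _

ptsTerms-⊆ : ∀ C → concatMap pairTerms (pts C) ⊆ heapTerms C
ptsTerms-⊆ C = xs⊆ys++xs _ (concatMap atomTerms (pure C)) ∘ xs⊆ys++xs _ (concatMap pairTerms (arrays C))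

ends∈ : ∀ C {L : List (Term × Term)} → concatMap pairTerms L ⊆ heapTerms C →
  ∀ {p} → p ∈ L → proj₁ p ∈ heapTerms C × proj₂ p ∈ heapTerms C
ends∈ C L⊆C p∈L = L⊆C (termsOf-⊆ pairTerms p∈L (here refl))
              , L⊆C (termsOf-⊆ pairTerms p∈L (there (here refl)))

array-ends∈ : ∀ C {p} → p ∈ arrays C → proj₁ p ∈ heapTerms C × proj₂ p ∈ heapTerms C
array-ends∈ C = ends∈ C (arrayTerms-⊆ C)

cell-ends∈ : ∀ C {p} → p ∈ pts C → proj₁ p ∈ heapTerms C × proj₂ p ∈ heapTerms C
cell-ends∈ C = ends∈ C (ptsTerms-⊆ C)

block-ends∈ : ∀ C {p} → p ∈ blocks C → proj₁ p ∈ heapTerms C × proj₂ p ∈ heapTerms C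
block-ends∈ C p∈ with ∈-++⁻ (arrays C) p∈
... | inj₁ p∈arrays = array-ends∈ C p∈arrays
... | inj₂ p∈cells with ∈-map⁻ _ p∈cells
...   | q , q∈pts , refl = let t∈ = proj₁ (cell-ends∈ C q∈pts) in t∈ , t∈

record Agree (T : List Term) (s s′ : Stack) : Set where
  field
    keep-< : ∀ {t u} → t ∈ T → u ∈ T → ⟦ t ⟧ s < ⟦ u ⟧ s → ⟦ t ⟧ s′ < ⟦ u ⟧ s′
    keep-≡ : ∀ {t u} → t ∈ T → u ∈ T → ⟦ t ⟧ s ≡ ⟦ u ⟧ s → ⟦ t ⟧ s′ ≡ ⟦ u ⟧ s′

  -- Non-strict inequalities split into the two preserved cases.
  keep-≤ : ∀ {t u} → t ∈ T → u ∈ T → ⟦ t ⟧ s ≤ ⟦ u ⟧ s → ⟦ t ⟧ s′ ≤ ⟦ u ⟧ s′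
  keep-≤ t∈ u∈ t≤u with m≤n⇒m<n∨m≡n t≤u
  ... | inj₁ t<u = <⇒≤ (keep-< t∈ u∈ t<u)
  ... | inj₂ t≡u = ≤-reflexive (keep-≡ t∈ u∈ t≡u)

  -- Disequalities are preserved because s orders any two distinct values strictly.
  keep-≢ : ∀ {t u} → t ∈ T → u ∈ T → ⟦ t ⟧ s ≢ ⟦ u ⟧ s → ⟦ t ⟧ s′ ≢ ⟦ u ⟧ s′
  keep-≢ {t} {u} t∈ u∈ t≢u t≡u′ with <-cmp (⟦ t ⟧ s) (⟦ u ⟧ s)
  ... | tri< t<u _ _ = <-irrefl t≡u′ (keep-< t∈ u∈ t<u)
  ... | tri≈ _ t≡u _ = t≢u t≡u
  ... | tri> _ _ u<t = <-irrefl (sym t≡u′) (keep-< u∈ t∈ u<t)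

  restrict : ∀ {T′} → T′ ⊆ T → Agree T′ s s′
  restrict T′⊆T = record { keep-< = λ t∈ u∈ → keep-< (T′⊆T t∈) (T′⊆T u∈)
                         ; keep-≡ = λ t∈ u∈ → keep-≡ (T′⊆T t∈) (T′⊆T u∈) }

open Agree

agree-atom : ∀ {s s′} a → Agree (atomTerms a) s s′ → s ⊨ₐ a → s′ ⊨ₐ a
agree-atom (eqA t u)  ag = keep-≡ ag (here refl) (there (here refl))
agree-atom (neqA t u) ag = keep-≢ ag (here refl) (there (here refl))
agree-atom (leA t u)  ag = keep-≤ ag (here refl) (there (here refl))
agree-atom (ltA t u)  ag = keep-< ag (here refl) (there (here refl))

agree-pure : ∀ {s s′} Π → Agree (concatMap atomTerms Π) s s′ → s ⊨ₚ Π → s′ ⊨ₚ Π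
agree-pure Π ag sΠ = All.tabulate λ {a} a∈Π →
  agree-atom a (restrict ag (termsOf-⊆ atomTerms a∈Π)) (All.lookup sΠ a∈Π)

-- γ(C) compares only terms of C, so it transfers along agreement on them.
agree-γ : ∀ {s s′} C → Agree (heapTerms C) s s′ → γ C s → γ C s′
agree-γ C ag (sΠ , ordered , disjoint) =
    agree-pure (pure C) (restrict ag (pureTerms-⊆ C)) sΠ
  , All.tabulate (λ p∈ → keep-≤ ag (lo p∈) (hi p∈) (All.lookup ordered p∈))
  , AllPairs-mapWith∈ (blocks C)
      (λ p∈ q∈ → Sum.map (keep-< ag (hi p∈) (lo q∈)) (keep-< ag (hi q∈) (lo p∈))) disjoint
  where
  lo : ∀ {p} → p ∈ blocks C → proj₁ p ∈ heapTerms C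
  lo = proj₁ ∘ block-ends∈ C
  hi : ∀ {p} → p ∈ blocks C → proj₂ p ∈ heapTerms C
  hi = proj₂ ∘ block-ends∈ C

-- β(A,B) compares only terms of A and B, so it transfers along agreement on T(A,B).
agree-β : ∀ {s s′} A B → Agree (TAB A B) s s′ → β A B s → β A B s′
agree-β A B ag (γA , γB , outside , functional) =
    agree-γ A (restrict ag inA) γA
  , agree-γ B (restrict ag inB) γB
  , All.tabulate (λ vw∈ → All.tabulate (λ ab∈ →
      Sum.map (keep-< ag (inB (proj₁ (cell-ends∈ B vw∈))) (inA (proj₁ (array-ends∈ A ab∈))))
              (keep-< ag (inA (proj₂ (array-ends∈ A ab∈))) (inB (proj₁ (cell-ends∈ B vw∈))))
        (All.lookup (All.lookup outside vw∈) ab∈)))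
  , All.tabulate (λ tu∈ → All.tabulate (λ vw∈ →
      Sum.map (keep-≢ ag (inA (proj₁ (cell-ends∈ A tu∈))) (inB (proj₁ (cell-ends∈ B vw∈))))
              (keep-≡ ag (inA (proj₂ (cell-ends∈ A tu∈))) (inB (proj₂ (cell-ends∈ B vw∈))))
        (All.lookup (All.lookup functional tu∈) vw∈)))
  where
  inA : heapTerms A ⊆ TAB A B
  inA = xs⊆xs++ys _ _
  inB : heapTerms B ⊆ TAB A B
  inB = xs⊆ys++xs _ (heapTerms A) ∘ xs⊆xs++ys _ _

compareAtom : Stack → Term → Term → SeedAtom
compareAtom s t u with <-cmp (⟦ t ⟧ s) (⟦ u ⟧ s)
... | tri< _ _ _ = ltS t u
... | tri≈ _ _ _ = eqS t u
... | tri> _ _ _ = ltS u t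

compareAtom-holds : ∀ s t u → ⟦ compareAtom s t u ⟧ₛ s
compareAtom-holds s t u with <-cmp (⟦ t ⟧ s) (⟦ u ⟧ s)
... | tri< t<u _ _ = t<u
... | tri≈ _ t≡u _ = t≡u
... | tri> _ _ u<t = u<t

compareAtom-terms : ∀ {T} s {t u} → t ∈ T → u ∈ T → seedTermsIn T (compareAtom s t u)
compareAtom-terms s {t} {u} t∈ u∈ with <-cmp (⟦ t ⟧ s) (⟦ u ⟧ s)
... | tri< _ _ _ = t∈ , u∈
... | tri≈ _ _ _ = t∈ , u∈
... | tri> _ _ _ = u∈ , t∈

compareAtom-shape : ∀ s t u →
  (compareAtom s t u ≡ ltS t u) ⊎ (compareAtom s t u ≡ ltS u t) ⊎ (compareAtom s t u ≡ eqS t u)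
compareAtom-shape s t u with <-cmp (⟦ t ⟧ s) (⟦ u ⟧ s)
... | tri< _ _ _ = inj₁ refl
... | tri≈ _ _ _ = inj₂ (inj₂ refl)
... | tri> _ _ _ = inj₂ (inj₁ refl)

compareAtom-keeps-< : ∀ s s′ t u → ⟦ compareAtom s t u ⟧ₛ s′ →
  ⟦ t ⟧ s < ⟦ u ⟧ s → ⟦ t ⟧ s′ < ⟦ u ⟧ s′
compareAtom-keeps-< s s′ t u holds t<u with <-cmp (⟦ t ⟧ s) (⟦ u ⟧ s)
... | tri< _ _ _    = holds
... | tri≈ t≮u _ _  = ⊥-elim (t≮u t<u)
... | tri> t≮u _ _  = ⊥-elim (t≮u t<u)

compareAtom-keeps-≡ : ∀ s s′ t u → ⟦ compareAtom s t u ⟧ₛ s′ →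
  ⟦ t ⟧ s ≡ ⟦ u ⟧ s → ⟦ t ⟧ s′ ≡ ⟦ u ⟧ s′
compareAtom-keeps-≡ s s′ t u holds t≡u with <-cmp (⟦ t ⟧ s) (⟦ u ⟧ s)
... | tri< _ t≢u _  = ⊥-elim (t≢u t≡u)
... | tri≈ _ _ _    = holds
... | tri> _ t≢u _  = ⊥-elim (t≢u t≡u)

diagram : Stack → List Term → List SeedAtom
diagram s T = cartesianProductWith (compareAtom s) T T

diagram-holds : ∀ s T → ⟦ diagram s T ⟧Δ s
diagram-holds s T = All.tabulate holds
  where
  holds : ∀ {δ} → δ ∈ diagram s T → ⟦ δ ⟧ₛ s
  holds δ∈ with ∈-cartesianProductWith⁻ (compareAtom s) T T δ∈
  ... | t , u , _ , _ , refl = compareAtom-holds s t u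

diagram-terms : ∀ s T → All (seedTermsIn T) (diagram s T)
diagram-terms s T = All.tabulate terms
  where
  terms : ∀ {δ} → δ ∈ diagram s T → seedTermsIn T δ
  terms δ∈ with ∈-cartesianProductWith⁻ (compareAtom s) T T δ∈
  ... | _ , _ , t∈ , u∈ , refl = compareAtom-terms s t∈ u∈

diagram-total : ∀ s T t u → t ∈ T → u ∈ T →
  (ltS t u ∈ diagram s T) ⊎ (ltS u t ∈ diagram s T) ⊎ (eqS t u ∈ diagram s T)
diagram-total s T t u t∈ u∈ = Sum.map recorded (Sum.map recorded recorded) (compareAtom-shape s t u)
  where
  recorded : ∀ {δ} → compareAtom s t u ≡ δ → δ ∈ diagram s T
  recorded eq = subst (_∈ diagram s T) eq (∈-cartesianProductWith⁺ (compareAtom s) t∈ u∈)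

diagram-agree : ∀ {s s′} T → ⟦ diagram s T ⟧Δ s′ → Agree T s s′
diagram-agree {s} {s′} T sat = record
  { keep-< = λ {t} {u} t∈ u∈ → compareAtom-keeps-< s s′ t u (recorded t∈ u∈)
  ; keep-≡ = λ {t} {u} t∈ u∈ → compareAtom-keeps-≡ s s′ t u (recorded t∈ u∈) }
  where
  recorded : ∀ {t u} → t ∈ T → u ∈ T → ⟦ compareAtom s t u ⟧ₛ s′
  recorded t∈ u∈ = All.lookup sat (∈-cartesianProductWith⁺ (compareAtom s) t∈ u∈)

theorem23 : (A B : SymHeap) → Satisfiable (β A B) →
    ∃ λ (Δ : List SeedAtom) → IsSolutionSeed A B Δ
theorem23 A B (s , βs) =
  diagram s T ,
  ( (s , diagram-holds s T)
  , (λ s′ sat → agree-β A B (diagram-agree T sat) βs) ) ,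
  diagram-terms s T ,
  diagram-total s T
  where
  T = TAB A B
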